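{- For every integer $k\geq 0$, $\left|\mathsf{APS}^+_{2k+1} \setminus \mathsf{APS}_{2k+1}\right|=4^k - \binom{2k}{k}$.
   Context: For $n\in\mathbb{N}$, $[n]=\{1,\dots,n\}$ and $\pm[n]=[n]\cup -[n]$. $\mathfrak{S}_n$ is the symmetric group of bijections of $[n]$, and $\mathfrak{S}_n^B$ is the group of signed permutations, i.e. bijections $w:\pm[n]\to\pm[n]$ with $w(-i)=-w(i)$, written in one-line notation $w(1)\cdots w(n)$ (so $\mathfrak{S}_n\subseteq\mathfrak{S}_n^B$). A pinnacle of $w$ is a value $w(i)$ with $2\le i\le n-1$ and $w(i-1)<w(i)>w(i+1)$; the pinnacle set of $w$ is the set of its pinnacles. $\mathsf{APS}_n$ is the set of pinnacle sets of elements of $\mathfrak{S}_n$, $\mathsf{APS}^B_n$ is the set of pinnacle sets of elements of $\mathfrak{S}_n^B$, and $\mathsf{APS}^+_n=\{S\in\mathsf{APS}^B_n : S\subset\mathbb{N}\}$, where $\mathbb{N}=\{1,2,3,\dots\}$. -}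

module Defs where

open import Data.Nat using (ℕ; zero; suc; _≤_; _<_)
open import Data.Integer as ℤ using (ℤ; +_; ∣_∣)
open import Data.Fin using (Fin; toℕ)
open import Data.List using (List)
open import Data.List.Membership.Propositional using (_∈_)
open import Data.Product using (Σ; _×_; ∃)
open import Relation.Nullary using (¬_)
open import Relation.Binary.PropositionalEquality using (_≡_)

-- A signed permutation of [n] in one-line notation w(1)⋯w(n), given as
-- w : Fin n → ℤ (position i : Fin n stands for i+1).  Such a w determines
-- the bijection of ±[n] via w(-i) = -w(i); the condition is that
-- i ↦ |w(i)| is a bijection [n] → [n] (values in [n], injective).
IsSignedPerm : (n : ℕ) → (Fin n → ℤ) → Set
IsSignedPerm n w =
  (∀ i → 1 ≤ ∣ w i ∣ × ∣ w i ∣ ≤ n) ×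
  (∀ i j → ∣ w i ∣ ≡ ∣ w j ∣ → i ≡ j)

IsPerm : (n : ℕ) → (Fin n → ℤ) → Set
IsPerm n w = IsSignedPerm n w × (∀ i → ℤ.+0 ℤ.< w i)

IsPinnacle : {n : ℕ} → (Fin n → ℤ) → ℤ → Set
IsPinnacle {n} w v =
  Σ (Fin n) λ i → Σ (Fin n) λ j → Σ (Fin n) λ k →
    (toℕ j ≡ suc (toℕ i)) × (toℕ k ≡ suc (toℕ j)) ×
    (w i ℤ.< w j) × (w k ℤ.< w j) × (v ≡ w j)

PinSetIs : {n : ℕ} → (Fin n → ℤ) → (ℕ → Set) → Set
PinSetIs w S =
  (∀ z → IsPinnacle w z → ∃ λ x → (z ≡ + x) × S x) ×
  (∀ x → S x → IsPinnacle w (+ x))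

InAPS⁺ : ℕ → (ℕ → Set) → Set
InAPS⁺ n S = Σ (Fin n → ℤ) λ w → IsSignedPerm n w × PinSetIs w S

InAPS : ℕ → (ℕ → Set) → Set
InAPS n S = Σ (Fin n → ℤ) λ w → IsPerm n w × PinSetIs w S

SameSet : (ℕ → Set) → (ℕ → Set) → Set
SameSet A B = ∀ x → (A x → B x) × (B x → A x)

HasCard : ((ℕ → Set) → Set) → ℕ → Set₁
HasCard P m =
  Σ (Fin m → List ℕ) λ f →
    (∀ i → P (λ x → x ∈ f i)) ×
    (∀ i j → SameSet (λ x → x ∈ f i) (λ x → x ∈ f j) → i ≡ j) ×
    (∀ S → P S → Σ (Fin m) λ i → SameSet S (λ x → x ∈ f i))

-- Encode S ⊆ [n] by the word b of length n whose (v − 1)st letter is `true` iff v ∈ S.  In any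
-- sequence the pinnacles occupy pairwise non-adjacent interior positions whose two neighbours are
-- smaller.  Counting positions gives 2|S| + 1 ≤ n for signed permutations and, applied to the
-- entries ≤ m of an ordinary permutation, 2|S ∩ [m]| + 1 ≤ m for every m ≥ 1: b is a ballot word.
-- Both conditions are sufficient.  Alternating the negated non-members (in decreasing order) with
-- the members realises the first; letting each member peak between the two oldest smaller values
-- not yet placed realises the second.  So for n = 2k + 1 the sets in APS⁺ ∖ APS are the words with
-- at most k letters `true` that are not ballot words.  Complementing all letters shows that half of
-- the 2^(2k+1) words are of the first kind, and Pascal's rule counts C(2k, k) ballot words.

module Submission where

open import Defs
open import Data.Nat using (ℕ; suc; _+_; _*_; _∸_; _^_)
open import Data.Nat.Combinatorics using (_C_)
open import Data.Product using (_×_)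
open import Relation.Nullary using (¬_)

open import Data.Bool using (Bool; true; false; T; not; _∧_)
open import Data.Bool.Properties using (T-∧)
open import Data.Empty using (⊥-elim)
open import Data.Fin using (Fin; toℕ; fromℕ<)
open import Data.Fin.Properties using (toℕ<n; toℕ-fromℕ<; fromℕ<-toℕ; toℕ-injective)
open import Data.Integer as ℤ using (ℤ; +_; ∣_∣)
import Data.Integer.Properties as ℤ
open import Data.List using (List; []; _∷_; length; map; _++_; [_]; applyUpTo; lookup; filterᵇ)
open import Data.List.Properties
  using ( length-++; length-map; length-applyUpTo; ∷-injectiveʳ; ++-assoc; ++-identityʳ
        ; map-++; map-∘; map-cong; map-id)
open import Data.List.Membership.Propositional using (_∈_)
open import Data.List.Membership.Propositional.Properties
  using (∈-++⁺ˡ; ∈-++⁺ʳ; ∈-++⁻; ∈-map⁺; ∈-map⁻; ∈-lookup; ∈-filter⁺; ∈-filter⁻)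
open import Data.List.Relation.Unary.Any as Any using (here; there)
open import Data.List.Relation.Unary.Any.Properties using (lookup-index)
open import Data.List.Relation.Unary.All as All using (All)
import Data.List.Relation.Unary.All.Properties as All
open import Data.List.Relation.Unary.AllPairs as AllPairs using (AllPairs)
import Data.List.Relation.Unary.AllPairs.Properties as AllPairs
open import Data.List.Relation.Unary.Unique.Propositional using (Unique)
import Data.List.Relation.Unary.Unique.Propositional.Properties as Unique
open import Data.List.Relation.Binary.Disjoint.Propositional using (Disjoint)
open import Data.List.Relation.Binary.Permutation.Propositional
  using (_↭_; prep; ↭-sym; ↭-trans; ↭-reflexive; ↭-refl; ↭⇒↭ₛ)
open import Data.List.Relation.Binary.Permutation.Propositional.Properties
  using (shift; map⁺; ++-comm; ∈-resp-↭; ↭-length)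
open import Data.Nat
open import Data.Nat.Combinatorics using (k>n⇒nCk≡0; nCk+nC[k+1]≡[n+1]C[k+1])
open import Data.Nat.Properties
open import Algebra.Properties.CommutativeSemigroup +-commutativeSemigroup using (x∙yz≈y∙xz; xy∙z≈y∙xz)
open import Data.Nat.Tactic.RingSolver using (solve-∀)
open import Data.Product using (Σ; ∃; _,_; proj₁; proj₂)
open import Data.Sum using (_⊎_; inj₁; inj₂)
open import Data.Unit using (tt)
open import Function using (_∘_)
open import Function.Bundles using (Equivalence)
open import Relation.Binary.PropositionalEquality hiding ([_])
open import Data.List.Relation.Binary.Permutation.Setoid.Properties (setoid ℕ) using (Unique-resp-↭)
open import Relation.Nullary using (Dec; yes; no; does; isYes; map′)
open import Relation.Nullary.Decidable using (_×-dec_; toWitness; fromWitness; dec-true; dec-false; T?)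

𝟙 : Bool → ℕ
𝟙 true  = 1
𝟙 false = 0

count : (ℕ → Bool) → ℕ → ℕ
count p zero    = 0
count p (suc n) = 𝟙 (p n) + count p n

count-cong : ∀ {p q} n → (∀ j → j < n → p j ≡ q j) → count p n ≡ count q n
count-cong zero    p≗q = refl
count-cong (suc n) p≗q =
  cong₂ _+_ (cong 𝟙 (p≗q n ≤-refl)) (count-cong n (λ j j<n → p≗q j (m<n⇒m<1+n j<n)))

count-true : ∀ n → count (λ _ → true) n ≡ n
count-true zero    = refl
count-true (suc n) = cong suc (count-true n)

count-pos : ∀ {p} j n → j < n → T (p j) → 1 ≤ count p n
count-pos {p} j (suc n) j<1+n pj with m≤n⇒m<n∨m≡n (≤-pred j<1+n)
... | inj₁ j<n  = ≤-trans (count-pos j n j<n pj) (m≤n+m _ _)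
... | inj₂ refl with p j
...   | true = s≤s z≤n

remove : (ℕ → Bool) → ℕ → ℕ → Bool
remove p x j = p j ∧ not (does (j ≟ x))

remove-≢ : ∀ p {x j} → j ≢ x → remove p x j ≡ p j
remove-≢ p {x} {j} j≢x rewrite dec-false (j ≟ x) j≢x with p j
... | true  = refl
... | false = refl

count-remove : ∀ {p x} M → x < M → T (p x) → count p M ≡ suc (count (remove p x) M)
count-remove {p} {x} (suc M) x<1+M px with m≤n⇒m<n∨m≡n (≤-pred x<1+M)
... | inj₁ x<M rewrite remove-≢ p (>⇒≢ x<M) =
  trans (cong (_+_ (𝟙 (p M))) (count-remove M x<M px)) (+-suc _ _)
... | inj₂ refl rewrite dec-true (x ≟ x) refl with p x
...   | true = cong suc (count-cong x (λ j j<x → sym (remove-≢ p (<⇒≢ j<x))))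

count-≤-injection : ∀ {p q : ℕ → Bool} (ψ : ℕ → ℕ) N M →
  (∀ v → v < N → T (p v) → ψ v < M × T (q (ψ v))) →
  (∀ u v → u < N → v < N → T (p u) → T (p v) → ψ u ≡ ψ v → u ≡ v) →
  count p N ≤ count q M
count-≤-injection ψ zero M into inj = z≤n
count-≤-injection {p} {q} ψ (suc N) M into inj with p N in pN≡
... | false = count-≤-injection ψ N M into′ inj′
  where
  into′ = λ v v<N → into v (m<n⇒m<1+n v<N)
  inj′ = λ u v u<N v<N → inj u v (m<n⇒m<1+n u<N) (m<n⇒m<1+n v<N)
... | true = begin
  suc (count p N)             ≤⟨ s≤s (count-≤-injection ψ N M into′ inj′) ⟩
  suc (count (remove q t) M)  ≡⟨ count-remove M (proj₁ (into N ≤-refl pN)) (proj₂ (into N ≤-refl pN)) ⟨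
  count q M                   ∎
  where
  open ≤-Reasoning
  pN : T (p N)
  pN = subst T (sym pN≡) tt
  t = ψ N
  inj′ = λ u v u<N v<N → inj u v (m<n⇒m<1+n u<N) (m<n⇒m<1+n v<N)
  into′ : ∀ v → v < N → T (p v) → ψ v < M × T (remove q t (ψ v))
  into′ v v<N pv = proj₁ (into v (m<n⇒m<1+n v<N) pv) ,
    subst T (sym (remove-≢ q (λ ψv≡t → <-irrefl (inj v N (m<n⇒m<1+n v<N) ≤-refl pv pN ψv≡t) v<N)))
      (proj₂ (into v (m<n⇒m<1+n v<N) pv))

count-shift : ∀ f m → count f (suc m) ≡ 𝟙 (f 0) + count (f ∘ suc) m
count-shift f zero    = refl
count-shift f (suc m) =
  trans (cong (_+_ (𝟙 (f (suc m)))) (count-shift f m)) (x∙yz≈y∙xz (𝟙 (f (suc m))) (𝟙 (f 0)) _)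

record SparsePeaks (n : ℕ) (small peak : ℕ → Bool) : Set where
  field
    no-peak-at-0   : peak 0 ≡ false
    peak-interior  : ∀ a → T (peak (suc a)) → suc (suc a) < n
    peak-small     : ∀ a → T (peak (suc a)) → T (small a) × T (small (suc a)) × T (small (suc (suc a)))
    peaks-isolated : ∀ j → T (peak j) → ¬ T (peak (suc j))

sgn : ℕ → ℕ
sgn zero    = 0
sgn (suc _) = 1

sgn-pos : ∀ {c} → 1 ≤ c → 1 ≤ sgn c
sgn-pos (s≤s _) = s≤s z≤n

module _ {n : ℕ} {small peak : ℕ → Bool} (sparse : SparsePeaks n small peak) where
  open SparsePeaks sparse

  private
    pending : ℕ → ℕ
    pending zero    = 0
    pending (suc m) = 𝟙 (peak m)

    pending≤sgn : ∀ m → pending m ≤ sgn (count small m)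
    pending≤sgn zero = z≤n
    pending≤sgn (suc zero) rewrite no-peak-at-0 = z≤n
    pending≤sgn (suc (suc a)) with peak (suc a) in pa
    ... | false = z≤n
    ... | true  = sgn-pos (count-pos {small} a (suc (suc a)) (m<n⇒m<1+n ≤-refl)
                                     (proj₁ (peak-small a (subst T (sym pa) tt))))

    pending-small : ∀ m → ¬ T (small m) → pending m ≡ 0
    pending-small zero          _   = refl
    pending-small (suc zero)    _   = cong 𝟙 no-peak-at-0
    pending-small (suc (suc a)) ¬sm with peak (suc a) in pa
    ... | false = refl
    ... | true  = ⊥-elim (¬sm (proj₂ (proj₂ (peak-small a (subst T (sym pa) tt)))))

    -- After scanning the positions below m, a peak at m - 1 still owes its right neighbour.
    invariant : ∀ m → 2 * count peak m + sgn (count small m) ≤ pending m + count small m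

    twice-peaks≤small : ∀ m → 2 * count peak m ≤ count small m
    twice-peaks≤small m = +-cancelʳ-≤ (sgn (count small m)) _ _ (begin
      2 * count peak m + sgn (count small m)  ≤⟨ invariant m ⟩
      pending m + count small m               ≤⟨ +-monoˡ-≤ _ (pending≤sgn m) ⟩
      sgn (count small m) + count small m     ≡⟨ +-comm _ (count small m) ⟩
      count small m + sgn (count small m)     ∎)
      where open ≤-Reasoning

    invariant zero = z≤n
    invariant (suc m) with peak m in pm | small m in sm
    ... | false | false =
      ≤-trans (invariant m) (≤-reflexive (cong (_+ count small m) (pending-small m (subst T sm))))
    ... | false | true  = subst (_≤ suc (count small m)) (+-comm 1 _) (s≤s (twice-peaks≤small m))
    invariant (suc zero) | true | _ with () ← trans (sym pm) no-peak-at-0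
    invariant (suc (suc a)) | true | false =
      ⊥-elim (subst T sm (proj₁ (proj₂ (peak-small a (subst T (sym pm) tt)))))
    invariant (suc (suc a)) | true | true = begin
      2 * suc (count peak (suc a)) + 1   ≡⟨ cong (_+ 1) (*-suc 2 _) ⟩
      2 + (2 * count peak (suc a) + 1)   ≤⟨ +-monoʳ-≤ 2 (begin
        2 * count peak (suc a) + 1
          ≤⟨ +-monoʳ-≤ _ (sgn-pos (count-pos {small} a (suc a) ≤-refl (proj₁ peak-nbrs))) ⟩
        2 * count peak (suc a) + sgn (count small (suc a))
          ≤⟨ invariant (suc a) ⟩
        pending (suc a) + count small (suc a)
          ≡⟨ cong (_+ count small (suc a)) (pending-before-peak a (subst T (sym pm) tt)) ⟩
        count small (suc a)                ∎) ⟩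
      2 + count small (suc a)            ∎
      where
      open ≤-Reasoning
      peak-nbrs = peak-small a (subst T (sym pm) tt)
      pending-before-peak : ∀ b → T (peak (suc b)) → pending (suc b) ≡ 0
      pending-before-peak b pb with peak b in pb′
      ... | true  = ⊥-elim (peaks-isolated b (subst T (sym pb′) tt) pb)
      ... | false = refl

    pending-at-end : pending n ≡ 0
    pending-at-end = go n refl
      where
      go : ∀ m → m ≡ n → pending m ≡ 0
      go zero _ = refl
      go (suc zero) _ = cong 𝟙 no-peak-at-0
      go (suc (suc a)) m≡n with peak (suc a) in pa
      ... | true  = ⊥-elim (<-irrefl m≡n (peak-interior a (subst T (sym pa) tt)))
      ... | false = refl

  sparsePeaks-bound : ∀ {m} → 1 ≤ m → count small n ≤ m → 2 * count peak n + 1 ≤ m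
  sparsePeaks-bound {m} 1≤m small≤m with count small n | invariant n | pending-at-end
  ... | zero  | inv | pend rewrite pend | n≤0⇒n≡0 (m+n≤o⇒m≤o (2 * count peak n) inv) = 1≤m
  ... | suc c | inv | pend rewrite pend = ≤-trans inv small≤m

-- Words and ballot walks

ones : List Bool → ℕ
ones []       = 0
ones (b ∷ bs) = 𝟙 b + ones bs

ones-applyUpTo : ∀ f n → ones (applyUpTo f n) ≡ count f n
ones-applyUpTo f zero    = refl
ones-applyUpTo f (suc n) = trans (cong (_+_ (𝟙 (f 0))) (ones-applyUpTo (f ∘ suc) n)) (sym (count-shift f n))

-- The walk starts at height h; `false` steps up, `true` steps down and the walk must stay at height ≥ 1.
ballot : ℕ → List Bool → Bool
ballot h             []           = true
ballot h             (false ∷ bs) = ballot (suc h) bs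
ballot (suc (suc h)) (true ∷ bs)  = ballot (suc h) bs
ballot _             (true ∷ _)   = false

ballot-weight : ∀ h bs → T (ballot (suc h) bs) → 2 * ones bs ≤ h + length bs
ballot-weight h [] _ = z≤n
ballot-weight h (false ∷ bs) walk = ≤-trans (ballot-weight (suc h) bs walk) (≤-reflexive (sym (+-suc h _)))
ballot-weight zero    (true ∷ bs) ()
ballot-weight (suc h) (true ∷ bs) walk = begin
  2 * suc (ones bs)          ≡⟨ *-suc 2 (ones bs) ⟩
  2 + 2 * ones bs            ≤⟨ +-monoʳ-≤ 2 (ballot-weight h bs walk) ⟩
  2 + (h + length bs)        ≡⟨ cong suc (sym (+-suc h _)) ⟩
  suc h + suc (length bs)    ∎
  where open ≤-Reasoning

ballot₀-weight : ∀ bs → T (ballot 0 bs) → 2 * ones bs ≤ pred (length bs)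
ballot₀-weight []           _    = z≤n
ballot₀-weight (false ∷ bs) walk = ballot-weight 0 bs walk
ballot₀-weight (true ∷ bs)  ()

prefixBounds⇒ballot : ∀ {f : ℕ → Bool} n h →
  (∀ m → 1 ≤ m → m ≤ n → 2 * count f m + 1 ≤ m + h) → T (ballot h (applyUpTo f n))
prefixBounds⇒ballot zero h bound = tt
prefixBounds⇒ballot {f} (suc n) h bound with f 0 in f0 | bound 1 (s≤s z≤n) (s≤s z≤n)
... | false | _ = prefixBounds⇒ballot n (suc h) λ m _ m≤n → begin
  2 * count (f ∘ suc) m + 1   ≡⟨ cong (λ c → 2 * c + 1) (count-tail m) ⟨
  2 * count f (suc m) + 1     ≤⟨ bound (suc m) (s≤s z≤n) (s≤s m≤n) ⟩
  suc m + h                   ≡⟨ +-suc m h ⟨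
  m + suc h                   ∎
  where
  open ≤-Reasoning
  count-tail : ∀ m → count f (suc m) ≡ count (f ∘ suc) m
  count-tail m = trans (count-shift f m) (cong (λ b → 𝟙 b + count (f ∘ suc) m) f0)
prefixBounds⇒ballot (suc n) zero       bound | true | s≤s ()
prefixBounds⇒ballot (suc n) (suc zero) bound | true | s≤s (s≤s ())
prefixBounds⇒ballot {f} (suc n) (suc (suc h)) bound | true | _ = prefixBounds⇒ballot n (suc h) λ m _ m≤n →
  +-cancelˡ-≤ 2 _ _ (begin
    2 + (2 * count (f ∘ suc) m + 1)   ≡⟨ cong (_+ 1) (*-suc 2 _) ⟨
    2 * suc (count (f ∘ suc) m) + 1   ≡⟨ cong (λ c → 2 * c + 1) (count-tail m) ⟨
    2 * count f (suc m) + 1           ≤⟨ bound (suc m) (s≤s z≤n) (s≤s m≤n) ⟩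
    suc m + suc (suc h)               ≡⟨ cong suc (+-suc m (suc h)) ⟩
    2 + (m + suc h)                   ∎)
  where
  open ≤-Reasoning
  count-tail : ∀ m → count f (suc m) ≡ suc (count (f ∘ suc) m)
  count-tail m = trans (count-shift f m) (cong (λ b → 𝟙 b + count (f ∘ suc) m) f0)

-- Counting words

bitStrings : ℕ → List (List Bool)
bitStrings zero    = [] ∷ []
bitStrings (suc n) = map (false ∷_) (bitStrings n) ++ map (true ∷_) (bitStrings n)

length-bitStrings : ∀ n → length (bitStrings n) ≡ 2 ^ n
length-bitStrings zero    = refl
length-bitStrings (suc n) = begin
  length (map (false ∷_) (bitStrings n) ++ map (true ∷_) (bitStrings n))
    ≡⟨ length-++ (map (false ∷_) (bitStrings n)) ⟩
  length (map (false ∷_) (bitStrings n)) + length (map (true ∷_) (bitStrings n))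
    ≡⟨ cong₂ _+_ (length-map _ (bitStrings n)) (length-map _ (bitStrings n)) ⟩
  length (bitStrings n) + length (bitStrings n)
    ≡⟨ cong (λ m → m + m) (length-bitStrings n) ⟩
  2 ^ n + 2 ^ n
    ≡⟨ cong (_+_ (2 ^ n)) (sym (+-identityʳ (2 ^ n))) ⟩
  2 ^ suc n ∎
  where open ≡-Reasoning

∈-bitStrings⁺ : ∀ bs → bs ∈ bitStrings (length bs)
∈-bitStrings⁺ []           = here refl
∈-bitStrings⁺ (false ∷ bs) = ∈-++⁺ˡ (∈-map⁺ (false ∷_) (∈-bitStrings⁺ bs))
∈-bitStrings⁺ (true ∷ bs)  =
  ∈-++⁺ʳ (map (false ∷_) (bitStrings (length bs))) (∈-map⁺ (true ∷_) (∈-bitStrings⁺ bs))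

∈-bitStrings⁻ : ∀ n {bs} → bs ∈ bitStrings n → length bs ≡ n
∈-bitStrings⁻ zero (here refl) = refl
∈-bitStrings⁻ (suc n) bs∈ with ∈-++⁻ (map (false ∷_) (bitStrings n)) bs∈
... | inj₁ ∈ˡ with _ , cs∈ , refl ← ∈-map⁻ (false ∷_) ∈ˡ = cong suc (∈-bitStrings⁻ n cs∈)
... | inj₂ ∈ʳ with _ , cs∈ , refl ← ∈-map⁻ (true ∷_) ∈ʳ = cong suc (∈-bitStrings⁻ n cs∈)

bitStrings-unique : ∀ n → Unique (bitStrings n)
bitStrings-unique zero    = All.[] AllPairs.∷ AllPairs.[]
bitStrings-unique (suc n) =
  Unique.++⁺ (Unique.map⁺ ∷-injectiveʳ (bitStrings-unique n))
             (Unique.map⁺ ∷-injectiveʳ (bitStrings-unique n)) disjoint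
  where
  disjoint : Disjoint (map (false ∷_) (bitStrings n)) (map (true ∷_) (bitStrings n))
  disjoint (∈ˡ , ∈ʳ) with _ , _ , refl ← ∈-map⁻ (false ∷_) ∈ˡ | _ , _ , () ← ∈-map⁻ (true ∷_) ∈ʳ

countᴸ : {A : Set} → (A → Bool) → List A → ℕ
countᴸ p []       = 0
countᴸ p (x ∷ xs) = 𝟙 (p x) + countᴸ p xs

length-filterᵇ : {A : Set} (p : A → Bool) (xs : List A) → length (filterᵇ p xs) ≡ countᴸ p xs
length-filterᵇ p []       = refl
length-filterᵇ p (x ∷ xs) with p x
... | true  = cong suc (length-filterᵇ p xs)
... | false = length-filterᵇ p xs

countᴸ-++ : {A : Set} (p : A → Bool) (xs ys : List A) → countᴸ p (xs ++ ys) ≡ countᴸ p xs + countᴸ p ys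
countᴸ-++ p []       ys = refl
countᴸ-++ p (x ∷ xs) ys = trans (cong (_+_ (𝟙 (p x))) (countᴸ-++ p xs ys)) (sym (+-assoc (𝟙 (p x)) _ _))

countᴸ-map : {A B : Set} (p : B → Bool) (f : A → B) (xs : List A) → countᴸ p (map f xs) ≡ countᴸ (p ∘ f) xs
countᴸ-map p f []       = refl
countᴸ-map p f (x ∷ xs) = cong (_+_ (𝟙 (p (f x)))) (countᴸ-map p f xs)

countᴸ-cong : {A : Set} {p q : A → Bool} (xs : List A) →
  (∀ {x} → x ∈ xs → p x ≡ q x) → countᴸ p xs ≡ countᴸ q xs
countᴸ-cong []       p≗q = refl
countᴸ-cong (x ∷ xs) p≗q = cong₂ _+_ (cong 𝟙 (p≗q (here refl))) (countᴸ-cong xs (p≗q ∘ there))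

countᴸ-false : {A : Set} (xs : List A) → countᴸ (λ _ → false) xs ≡ 0
countᴸ-false []       = refl
countᴸ-false (x ∷ xs) = countᴸ-false xs

countᴸ-+-not : {A : Set} (p : A → Bool) (xs : List A) → countᴸ p xs + countᴸ (not ∘ p) xs ≡ length xs
countᴸ-+-not p []       = refl
countᴸ-+-not p (x ∷ xs) with p x
... | true  = cong suc (countᴸ-+-not p xs)
... | false = trans (+-suc (countᴸ p xs) _) (cong suc (countᴸ-+-not p xs))

countᴸ-∧-not : {A : Set} (p q : A → Bool) (xs : List A) → (∀ {x} → x ∈ xs → T (q x) → T (p x)) →
  countᴸ (λ x → p x ∧ not (q x)) xs + countᴸ q xs ≡ countᴸ p xs
countᴸ-∧-not p q []       q⇒p = refl
countᴸ-∧-not p q (x ∷ xs) q⇒p with p x in px | q x in qx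
... | true  | true  = trans (+-suc _ _) (cong suc (countᴸ-∧-not p q xs (q⇒p ∘ there)))
... | true  | false = cong suc (countᴸ-∧-not p q xs (q⇒p ∘ there))
... | false | false = countᴸ-∧-not p q xs (q⇒p ∘ there)
... | false | true  = ⊥-elim (subst T px (q⇒p (here refl) (subst T (sym qx) tt)))

countᴸ-bitStrings-suc : ∀ (p : List Bool → Bool) n → countᴸ p (bitStrings (suc n)) ≡
  countᴸ (p ∘ (false ∷_)) (bitStrings n) + countᴸ (p ∘ (true ∷_)) (bitStrings n)
countᴸ-bitStrings-suc p n = trans (countᴸ-++ p (map (false ∷_) (bitStrings n)) _)
  (cong₂ _+_ (countᴸ-map p (false ∷_) (bitStrings n)) (countᴸ-map p (true ∷_) (bitStrings n)))

countᴸ-bitStrings-complement : ∀ (p : List Bool → Bool) n →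
  countᴸ p (bitStrings n) ≡ countᴸ (p ∘ map not) (bitStrings n)
countᴸ-bitStrings-complement p zero    = refl
countᴸ-bitStrings-complement p (suc n) = begin
  countᴸ p (bitStrings (suc n))
    ≡⟨ countᴸ-bitStrings-suc p n ⟩
  countᴸ (p ∘ (false ∷_)) (bitStrings n) + countᴸ (p ∘ (true ∷_)) (bitStrings n)
    ≡⟨ cong₂ _+_ (countᴸ-bitStrings-complement (p ∘ (false ∷_)) n)
                 (countᴸ-bitStrings-complement (p ∘ (true ∷_)) n) ⟩
  countᴸ (λ b → p (false ∷ map not b)) (bitStrings n) + countᴸ (λ b → p (true ∷ map not b)) (bitStrings n)
    ≡⟨ +-comm (countᴸ (λ b → p (false ∷ map not b)) (bitStrings n)) _ ⟩
  countᴸ (λ b → p (true ∷ map not b)) (bitStrings n) + countᴸ (λ b → p (false ∷ map not b)) (bitStrings n)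
    ≡⟨ sym (countᴸ-bitStrings-suc (p ∘ map not) n) ⟩
  countᴸ (p ∘ map not) (bitStrings (suc n)) ∎
  where open ≡-Reasoning

ones-map-not : ∀ bs → ones (map not bs) + ones bs ≡ length bs
ones-map-not []           = refl
ones-map-not (true ∷ bs)  = trans (+-suc (ones (map not bs)) _) (cong suc (ones-map-not bs))
ones-map-not (false ∷ bs) = cong suc (ones-map-not bs)

≤ᵇ-half-complement : ∀ a b k → a + b ≡ suc (2 * k) → not (a ≤ᵇ k) ≡ (b ≤ᵇ k)
≤ᵇ-half-complement a b k a+b≡ with a ≤ᵇ k in a≤ᵇk | b ≤ᵇ k in b≤ᵇk
... | true  | false = refl
... | false | true  = refl
... | true  | true  = ⊥-elim (<-irrefl refl (begin-strict
  2 * k              <⟨ n<1+n (2 * k) ⟩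
  suc (2 * k)        ≡⟨ sym a+b≡ ⟩
  a + b              ≤⟨ +-mono-≤ (≤ᵇ⇒≤ a k (subst T (sym a≤ᵇk) tt)) (≤ᵇ⇒≤ b k (subst T (sym b≤ᵇk) tt)) ⟩
  k + k              ≡⟨ cong (_+_ k) (sym (+-identityʳ k)) ⟩
  2 * k              ∎))
  where open ≤-Reasoning
... | false | false = ⊥-elim (<-irrefl refl (begin-strict
  suc (2 * k)        ≡⟨ cong (λ m → suc (k + m)) (+-identityʳ k) ⟩
  suc k + k          <⟨ +-monoʳ-< (suc k) (n<1+n k) ⟩
  suc k + suc k      ≤⟨ +-mono-≤ (≰⇒> (above {a} a≤ᵇk)) (≰⇒> (above {b} b≤ᵇk)) ⟩
  a + b              ≡⟨ a+b≡ ⟩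
  suc (2 * k)        ∎))
  where
  open ≤-Reasoning
  above : ∀ {m} → (m ≤ᵇ k) ≡ false → ¬ m ≤ k
  above {m} m≤ᵇk m≤k = subst T m≤ᵇk (≤⇒≤ᵇ m≤k)

light-count : ∀ k → countᴸ (λ bs → ones bs ≤ᵇ k) (bitStrings (suc (2 * k))) ≡ 4 ^ k
light-count k = *-cancelˡ-≡ _ _ 2 (begin
  2 * c                                  ≡⟨ cong (_+_ c) (+-identityʳ c) ⟩
  c + c                                  ≡⟨ cong (_+_ c) c≡heavy ⟩
  c + countᴸ (not ∘ light) V             ≡⟨ countᴸ-+-not light V ⟩
  length V                               ≡⟨ length-bitStrings (suc (2 * k)) ⟩
  2 ^ suc (2 * k)                        ≡⟨ cong (2 *_) (sym (^-*-assoc 2 2 k)) ⟩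
  2 * 4 ^ k                              ∎)
  where
  open ≡-Reasoning
  V = bitStrings (suc (2 * k))
  light : List Bool → Bool
  light bs = ones bs ≤ᵇ k
  c = countᴸ light V
  c≡heavy : c ≡ countᴸ (not ∘ light) V
  c≡heavy = sym (trans (countᴸ-bitStrings-complement (not ∘ light) (suc (2 * k)))
    (countᴸ-cong V λ {bs} bs∈ → ≤ᵇ-half-complement (ones (map not bs)) (ones bs) k
      (trans (ones-map-not bs) (∈-bitStrings⁻ (suc (2 * k)) bs∈))))

binomialSum : ℕ → ℕ → ℕ → ℕ
binomialSum n l zero      = 0
binomialSum n l (suc len) = n C l + binomialSum n (suc l) len

binomialSum-beyond : ∀ n l len → n < l → binomialSum n l len ≡ 0
binomialSum-beyond n l zero      n<l = refl
binomialSum-beyond n l (suc len) n<l =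
  cong₂ _+_ (k>n⇒nCk≡0 n<l) (binomialSum-beyond n (suc l) len (m<n⇒m<1+n n<l))

binomialSum-last : ∀ n l len → binomialSum n l (suc len) ≡ binomialSum n l len + n C (l + len)
binomialSum-last n l zero      = trans (+-identityʳ _) (cong (n C_) (sym (+-identityʳ l)))
binomialSum-last n l (suc len) = begin
  n C l + binomialSum n (suc l) (suc len)
    ≡⟨ cong (_+_ (n C l)) (binomialSum-last n (suc l) len) ⟩
  n C l + (binomialSum n (suc l) len + n C (suc l + len))
    ≡⟨ +-assoc (n C l) _ _ ⟨
  binomialSum n l (suc len) + n C (suc l + len)
    ≡⟨ cong (λ i → binomialSum n l (suc len) + n C i) (+-suc l len) ⟨
  binomialSum n l (suc len) + n C (l + suc len) ∎
  where open ≡-Reasoning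

binomialSum-pascal : ∀ n l len →
  binomialSum (suc n) (suc l) len ≡ binomialSum n (suc l) len + binomialSum n l len
binomialSum-pascal n l zero      = refl
binomialSum-pascal n l (suc len) = begin
  suc n C suc l + binomialSum (suc n) (suc (suc l)) len
    ≡⟨ cong₂ _+_ (sym (nCk+nC[k+1]≡[n+1]C[k+1] n l)) (binomialSum-pascal n (suc l) len) ⟩
  (n C l + n C suc l) + (binomialSum n (suc (suc l)) len + binomialSum n (suc l) len)
    ≡⟨ regroup (n C l) (n C suc l) _ _ ⟩
  (n C suc l + binomialSum n (suc (suc l)) len) + (n C l + binomialSum n (suc l) len) ∎
  where
  open ≡-Reasoning
  regroup : ∀ a b c d → (a + b) + (c + d) ≡ (b + c) + (a + d)
  regroup = solve-∀

ballotCount : ℕ → ℕ → ℕ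
ballotCount n h = countᴸ (ballot h) (bitStrings n)

ballotCount-suc-up : ∀ n h →
  ballotCount (suc n) (suc (suc h)) ≡ ballotCount n (suc (suc (suc h))) + ballotCount n (suc h)
ballotCount-suc-up n h = countᴸ-bitStrings-suc (ballot (suc (suc h))) n

ballotCount-suc-low : ∀ n h → h < 2 → ballotCount (suc n) h ≡ ballotCount n (suc h)
ballotCount-suc-low n h h<2 = begin
  ballotCount (suc n) h
    ≡⟨ countᴸ-bitStrings-suc (ballot h) n ⟩
  ballotCount n (suc h) + countᴸ (ballot h ∘ (true ∷_)) (bitStrings n)
    ≡⟨ cong (_+_ (ballotCount n (suc h))) (countᴸ-cong (bitStrings n) (λ _ → stuck h h<2)) ⟩
  ballotCount n (suc h) + countᴸ (λ _ → false) (bitStrings n)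
    ≡⟨ cong (_+_ (ballotCount n (suc h))) (countᴸ-false (bitStrings n)) ⟩
  ballotCount n (suc h) + 0
    ≡⟨ +-identityʳ _ ⟩
  ballotCount n (suc h) ∎
  where
  open ≡-Reasoning
  stuck : ∀ h {bs} → h < 2 → ballot h (true ∷ bs) ≡ false
  stuck zero          _ = refl
  stuck (suc zero)    _ = refl
  stuck (suc (suc h)) (s≤s (s≤s ()))

twice-suc+ : ∀ l h → 2 * suc l + h ≡ suc (2 * l + suc h)
twice-suc+ = solve-∀

-- Both sides obey Pascal's rule: the ballot walks of length n from height h + 1 are counted by the
-- h + 1 binomial coefficients n C l, …, n C (l + h), where l = ⌊(n − h) / 2⌋ (or l = 0 when n < h).
ballotCount-window : ∀ n h l → n ≤ suc (2 * l + h) → 2 * l + h ≤ n ⊎ l ≡ 0 →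
  ballotCount n (suc h) ≡ binomialSum n l (suc h)
ballotCount-window zero h zero _ _ = cong suc (sym (binomialSum-beyond 0 1 h (s≤s z≤n)))
ballotCount-window zero h (suc l) _ (inj₁ ())
ballotCount-window zero h (suc l) _ (inj₂ ())
ballotCount-window (suc zero) zero zero _ _ = refl
ballotCount-window (suc (suc n)) zero zero (s≤s ()) _
ballotCount-window (suc n) zero (suc l) _ (inj₂ ())
ballotCount-window (suc n) zero (suc l) upper (inj₁ lower) = begin
  ballotCount (suc n) 1            ≡⟨ ballotCount-suc-low n 1 (s≤s (s≤s z≤n)) ⟩
  ballotCount n 2                  ≡⟨ ballotCount-window n 1 l upper′ (inj₁ lower′) ⟩
  n C l + (n C suc l + 0)          ≡⟨ cong (_+_ (n C l)) (+-identityʳ _) ⟩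
  n C l + n C suc l                ≡⟨ nCk+nC[k+1]≡[n+1]C[k+1] n l ⟩
  suc n C suc l                    ≡⟨ sym (+-identityʳ _) ⟩
  binomialSum (suc n) (suc l) 1    ∎
  where
  open ≡-Reasoning
  upper′ = subst (n ≤_) (twice-suc+ l 0) (≤-pred upper)
  lower′ = ≤-pred (subst (_≤ suc n) (twice-suc+ l 0) lower)
ballotCount-window (suc n) (suc h) zero upper _ = begin
  ballotCount (suc n) (suc (suc h))
    ≡⟨ ballotCount-suc-up n h ⟩
  ballotCount n (suc (suc (suc h))) + ballotCount n (suc h)
    ≡⟨ cong₂ _+_ (ballotCount-window n (suc (suc h)) 0 (m≤n⇒m≤1+n (m≤n⇒m≤1+n n≤1+h)) (inj₂ refl))
                 (ballotCount-window n h 0 n≤1+h (inj₂ refl)) ⟩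
  binomialSum n 0 (suc (suc (suc h))) + binomialSum n 0 (suc h)
    ≡⟨ cong (_+ binomialSum n 0 (suc h)) (trans (binomialSum-last n 0 (suc (suc h)))
         (trans (cong (_+_ (binomialSum n 0 (suc (suc h)))) (k>n⇒nCk≡0 (s≤s n≤1+h))) (+-identityʳ _))) ⟩
  binomialSum n 0 (suc (suc h)) + binomialSum n 0 (suc h)
    ≡⟨ sym (cong suc (binomialSum-pascal n 0 (suc h))) ⟩
  binomialSum (suc n) 0 (suc (suc h))
    ∎
  where
  open ≡-Reasoning
  n≤1+h = ≤-pred upper
ballotCount-window (suc n) (suc h) (suc l) _ (inj₂ ())
ballotCount-window (suc n) (suc h) (suc l) upper (inj₁ lower) = begin
  ballotCount (suc n) (suc (suc h))
    ≡⟨ ballotCount-suc-up n h ⟩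
  ballotCount n (suc (suc (suc h))) + ballotCount n (suc h)
    ≡⟨ cong₂ _+_ (ballotCount-window n (suc (suc h)) l upper₁ (inj₁ lower₁))
                 (ballotCount-window n h (suc l) upper₂ (inj₁ lower₂)) ⟩
  (n C l + binomialSum n (suc l) (suc (suc h))) + binomialSum n (suc l) (suc h)
    ≡⟨ xy∙z≈y∙xz (n C l) _ _ ⟩
  binomialSum n (suc l) (suc (suc h)) + binomialSum n l (suc (suc h))
    ≡⟨ sym (binomialSum-pascal n l (suc (suc h))) ⟩
  binomialSum (suc n) (suc l) (suc (suc h))
    ∎
  where
  open ≡-Reasoning
  upper₁ = subst (n ≤_) (twice-suc+ l (suc h)) (≤-pred upper)
  lower₁ = ≤-pred (subst (_≤ suc n) (twice-suc+ l (suc h)) lower)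
  upper₂ = subst (n ≤_) (+-suc (2 * suc l) h) (≤-pred upper)
  lower₂ = ≤-pred (subst (_≤ suc n) (+-suc (2 * suc l) h) lower)

ballot-count : ∀ k → ballotCount (suc (2 * k)) 0 ≡ (2 * k) C k
ballot-count k = begin
  ballotCount (suc (2 * k)) 0   ≡⟨ ballotCount-suc-low (2 * k) 0 (s≤s z≤n) ⟩
  ballotCount (2 * k) 1         ≡⟨ ballotCount-window (2 * k) 0 k upper (inj₁ lower) ⟩
  (2 * k) C k + 0               ≡⟨ +-identityʳ _ ⟩
  (2 * k) C k                   ∎
  where
  open ≡-Reasoning
  lower = ≤-reflexive (+-identityʳ (2 * k))
  upper = m≤n⇒m≤1+n (≤-reflexive (sym (+-identityʳ (2 * k))))

-- Pinnacles of sequences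

-- The peak sits at position a + 1 of the sequence W of length n.
PeakAt : ℕ → (ℕ → ℤ) → ℕ → Set
PeakAt n W a = suc (suc a) < n × W a ℤ.< W (suc a) × W (suc (suc a)) ℤ.< W (suc a)

IsPinnacleℕ : ℕ → (ℕ → ℤ) → ℤ → Set
IsPinnacleℕ n W z = Σ ℕ λ a → PeakAt n W a × z ≡ W (suc a)

module _ {n : ℕ} (w : Fin n → ℤ) (W : ℕ → ℤ) (W≗w : ∀ i → W (toℕ i) ≡ w i) where

  W-fromℕ< : ∀ {j} (j<n : j < n) → W j ≡ w (fromℕ< j<n)
  W-fromℕ< j<n = trans (cong W (sym (toℕ-fromℕ< j<n))) (W≗w (fromℕ< j<n))

  isPinnacle⇒ℕ : ∀ {z} → IsPinnacle w z → IsPinnacleℕ n W z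
  isPinnacle⇒ℕ (i , j , k , j≡ , k≡ , wi<wj , wk<wj , z≡) =
    toℕ i , (subst (_< n) k≡′ (toℕ<n k) , subst₂ ℤ._<_ (sym (W≗w i)) Wj≡ wi<wj ,
             subst₂ ℤ._<_ (trans (sym (W≗w k)) (cong W k≡′)) Wj≡ wk<wj) ,
    trans z≡ Wj≡
    where
    k≡′ = trans k≡ (cong suc j≡)
    Wj≡ = trans (sym (W≗w j)) (cong W j≡)

  isPinnacleℕ⇒ : ∀ {z} → IsPinnacleℕ n W z → IsPinnacle w z
  isPinnacleℕ⇒ (a , (a+2<n , W<₁ , W<₂) , z≡) =
    fromℕ< a<n , fromℕ< a+1<n , fromℕ< a+2<n ,
    trans (toℕ-fromℕ< a+1<n) (cong suc (sym (toℕ-fromℕ< a<n))) ,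
    trans (toℕ-fromℕ< a+2<n) (cong suc (sym (toℕ-fromℕ< a+1<n))) ,
    subst₂ ℤ._<_ (W-fromℕ< a<n) (W-fromℕ< a+1<n) W<₁ , subst₂ ℤ._<_ (W-fromℕ< a+2<n) (W-fromℕ< a+1<n) W<₂ ,
    trans z≡ (W-fromℕ< a+1<n)
    where
    a+1<n = <-trans (n<1+n _) a+2<n
    a<n   = <-trans (n<1+n _) a+1<n

data HasPinnacle : List ℤ → ℤ → Set where
  here  : ∀ {a b c xs} → a ℤ.< b → c ℤ.< b → HasPinnacle (a ∷ b ∷ c ∷ xs) b
  there : ∀ {x xs v} → HasPinnacle xs v → HasPinnacle (x ∷ xs) v

nth : List ℤ → ℕ → ℤ
nth []       _       = + 0
nth (x ∷ xs) zero    = x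
nth (x ∷ xs) (suc j) = nth xs j

hasPinnacle⇒ℕ : ∀ {xs z} → HasPinnacle xs z → IsPinnacleℕ (length xs) (nth xs) z
hasPinnacle⇒ℕ (here a<b c<b) = 0 , (s≤s (s≤s (s≤s z≤n)) , a<b , c<b) , refl
hasPinnacle⇒ℕ (there p) with a , (a+2<n , W<₁ , W<₂) , z≡ ← hasPinnacle⇒ℕ p =
  suc a , (s≤s a+2<n , W<₁ , W<₂) , z≡

ℕ⇒hasPinnacle : ∀ xs {z} → IsPinnacleℕ (length xs) (nth xs) z → HasPinnacle xs z
ℕ⇒hasPinnacle (a ∷ b ∷ c ∷ xs) (zero , (_ , a<b , c<b) , refl) = here a<b c<b
ℕ⇒hasPinnacle (x ∷ xs) (suc a , (s≤s a+2<n , W<₁ , W<₂) , z≡) =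
  there (ℕ⇒hasPinnacle xs (a , (a+2<n , W<₁ , W<₂) , z≡))
ℕ⇒hasPinnacle (x ∷ [])     (zero , (s≤s () , _) , _)
ℕ⇒hasPinnacle (x ∷ y ∷ []) (zero , (s≤s (s≤s ()) , _) , _)

-- Realising words as pinnacle sets

upFrom : ℕ → ℕ → List ℕ
upFrom v zero    = []
upFrom v (suc n) = v ∷ upFrom (suc v) n

length-upFrom : ∀ v n → length (upFrom v n) ≡ n
length-upFrom v zero    = refl
length-upFrom v (suc n) = cong suc (length-upFrom (suc v) n)

∈-upFrom⁻ : ∀ {x} v n → x ∈ upFrom v n → v ≤ x × x < v + n
∈-upFrom⁻ v (suc n) (here refl) = ≤-refl , m<m+n v (s≤s z≤n)
∈-upFrom⁻ {x} v (suc n) (there x∈) with v<x , x<v+n ← ∈-upFrom⁻ (suc v) n x∈ =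
  <⇒≤ v<x , subst (λ m → x < m) (sym (+-suc v n)) x<v+n

upFrom-unique : ∀ v n → Unique (upFrom v n)
upFrom-unique v zero    = AllPairs.[]
upFrom-unique v (suc n) =
  All.¬Any⇒All¬ _ (λ v∈ → <-irrefl refl (proj₁ (∈-upFrom⁻ (suc v) n v∈))) AllPairs.∷ upFrom-unique (suc v) n

nth-∈ : ∀ xs {j} → j < length xs → nth xs j ∈ xs
nth-∈ (x ∷ xs) {zero}  _         = here refl
nth-∈ (x ∷ xs) {suc j} (s≤s j<n) = there (nth-∈ xs j<n)

nth-abs-injective : ∀ xs {i j} → Unique (map ∣_∣ xs) → i < length xs → j < length xs →
  ∣ nth xs i ∣ ≡ ∣ nth xs j ∣ → i ≡ j
nth-abs-injective (x ∷ xs) {zero}  {zero}  _ _ _ _ = refl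
nth-abs-injective (x ∷ xs) {zero}  {suc j} (x∉ AllPairs.∷ _) _ (s≤s j<n) eq =
  ⊥-elim (All.lookup x∉ (∈-map⁺ ∣_∣ (nth-∈ xs j<n)) eq)
nth-abs-injective (x ∷ xs) {suc i} {zero}  (x∉ AllPairs.∷ _) (s≤s i<n) _ eq =
  ⊥-elim (All.lookup x∉ (∈-map⁺ ∣_∣ (nth-∈ xs i<n)) (sym eq))
nth-abs-injective (x ∷ xs) {suc i} {suc j} (_ AllPairs.∷ unique) (s≤s i<n) (s≤s j<n) eq =
  cong suc (nth-abs-injective xs unique i<n j<n eq)

ListPinSetIs : List ℤ → (ℕ → Set) → Set
ListPinSetIs xs S =
  (∀ z → HasPinnacle xs z → ∃ λ x → (z ≡ + x) × S x) × (∀ x → S x → HasPinnacle xs (+ x))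

module _ (xs : List ℤ) where

  realize : Fin (length xs) → ℤ
  realize i = nth xs (toℕ i)

  realize-pinSet : ∀ {S} → ListPinSetIs xs S → PinSetIs realize S
  realize-pinSet (pin⇒S , S⇒pin) =
    (λ z z-pin → pin⇒S z (ℕ⇒hasPinnacle xs (isPinnacle⇒ℕ realize (nth xs) (λ _ → refl) z-pin))) ,
    (λ x x∈S → isPinnacleℕ⇒ realize (nth xs) (λ _ → refl) (hasPinnacle⇒ℕ (S⇒pin x x∈S)))

  realize-signedPerm : map ∣_∣ xs ↭ upFrom 1 (length xs) → IsSignedPerm (length xs) realize
  realize-signedPerm abs↭ = range , injective
    where
    range : ∀ i → 1 ≤ ∣ realize i ∣ × ∣ realize i ∣ ≤ length xs
    range i with 1≤ , <1+n ← ∈-upFrom⁻ 1 (length xs) (∈-resp-↭ abs↭ (∈-map⁺ ∣_∣ (nth-∈ xs (toℕ<n i)))) =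
      1≤ , ≤-pred <1+n
    injective : ∀ i j → ∣ realize i ∣ ≡ ∣ realize j ∣ → i ≡ j
    injective i j eq = toℕ-injective (nth-abs-injective xs
      (Unique-resp-↭ (↭⇒↭ₛ (↭-sym abs↭)) (upFrom-unique 1 (length xs))) (toℕ<n i) (toℕ<n j) eq)

abs↭upFrom⇒length : ∀ xs {n} → map ∣_∣ xs ↭ upFrom 1 n → length xs ≡ n
abs↭upFrom⇒length xs {n} abs↭ = trans (sym (length-map ∣_∣ xs)) (trans (↭-length abs↭) (length-upFrom 1 n))

list⇒InAPS⁺ : ∀ {n S} xs → map ∣_∣ xs ↭ upFrom 1 n → ListPinSetIs xs S → InAPS⁺ n S
list⇒InAPS⁺ xs abs↭ pins with refl ← abs↭upFrom⇒length xs abs↭ =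
  realize xs , realize-signedPerm xs abs↭ , realize-pinSet xs pins

map-∣∣-+ : ∀ ys → map ∣_∣ (map +_ ys) ≡ ys
map-∣∣-+ ys = trans (sym (map-∘ ys)) (map-id ys)

∣+∣-↭ : ∀ {ys zs} → ys ↭ zs → map ∣_∣ (map +_ ys) ↭ zs
∣+∣-↭ {ys} {zs} = subst (_↭ zs) (sym (map-∣∣-+ ys))

list⇒InAPS : ∀ {n S} ys → ys ↭ upFrom 1 n → ListPinSetIs (map +_ ys) S → InAPS n S
list⇒InAPS ys ys↭ pins with refl ← abs↭upFrom⇒length (map +_ ys) (∣+∣-↭ ys↭) =
  realize xs , (signed , positive) , realize-pinSet xs pins
  where
  xs = map +_ ys
  signed = realize-signedPerm xs (∣+∣-↭ ys↭)
  positive : ∀ i → ℤ.+0 ℤ.< realize xs i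
  positive i with y , _ , xi≡ ← ∈-map⁻ +_ (nth-∈ xs (toℕ<n i)) =
    subst (ℤ.+0 ℤ.<_) (sym xi≡) (ℤ.+<+ (subst (λ x → 1 ≤ ∣ x ∣) xi≡ (proj₁ (proj₁ signed i))))

support : ℕ → List Bool → List ℕ
support v []           = []
support v (true ∷ bs)  = v ∷ support (suc v) bs
support v (false ∷ bs) = support (suc v) bs

nonSupport : ℕ → List Bool → List ℕ
nonSupport v []           = []
nonSupport v (true ∷ bs)  = nonSupport (suc v) bs
nonSupport v (false ∷ bs) = v ∷ nonSupport (suc v) bs

support-≥ : ∀ v bs {x} → x ∈ support v bs → v ≤ x
support-≥ v (true ∷ bs)  (here refl) = ≤-refl
support-≥ v (true ∷ bs)  (there x∈) = <⇒≤ (support-≥ (suc v) bs x∈)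
support-≥ v (false ∷ bs) x∈         = <⇒≤ (support-≥ (suc v) bs x∈)

nonSupport-≥ : ∀ v bs {x} → x ∈ nonSupport v bs → v ≤ x
nonSupport-≥ v (false ∷ bs) (here refl) = ≤-refl
nonSupport-≥ v (false ∷ bs) (there x∈) = <⇒≤ (nonSupport-≥ (suc v) bs x∈)
nonSupport-≥ v (true ∷ bs)  x∈         = <⇒≤ (nonSupport-≥ (suc v) bs x∈)

nonSupport-increasing : ∀ v bs → AllPairs _<_ (nonSupport v bs)
nonSupport-increasing v []           = AllPairs.[]
nonSupport-increasing v (true ∷ bs)  = nonSupport-increasing (suc v) bs
nonSupport-increasing v (false ∷ bs) =
  All.tabulate (nonSupport-≥ (suc v) bs) AllPairs.∷ nonSupport-increasing (suc v) bs

nonSupport++support↭ : ∀ v bs → nonSupport v bs ++ support v bs ↭ upFrom v (length bs)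
nonSupport++support↭ v []           = ↭-refl
nonSupport++support↭ v (true ∷ bs)  =
  ↭-trans (shift v (nonSupport (suc v) bs) (support (suc v) bs)) (prep v (nonSupport++support↭ (suc v) bs))
nonSupport++support↭ v (false ∷ bs) = prep v (nonSupport++support↭ (suc v) bs)

length-support : ∀ v bs → length (support v bs) ≡ ones bs
length-support v []           = refl
length-support v (true ∷ bs)  = cong suc (length-support (suc v) bs)
length-support v (false ∷ bs) = length-support (suc v) bs

length-nonSupport : ∀ v bs → length (nonSupport v bs) + ones bs ≡ length bs
length-nonSupport v []           = refl
length-nonSupport v (true ∷ bs)  = trans (+-suc _ _) (cong suc (length-nonSupport (suc v) bs))
length-nonSupport v (false ∷ bs) = cong suc (length-nonSupport (suc v) bs)

support-injective : ∀ v {bs cs} → length bs ≡ length cs →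
  SameSet (_∈ support v bs) (_∈ support v cs) → bs ≡ cs
support-injective v {[]}         {[]}         _ _ = refl
support-injective v {true ∷ bs}  {true ∷ cs}  len same =
  cong (true ∷_) (support-injective (suc v) (suc-injective len) λ x →
    untail bs cs (proj₁ (same x) ∘ there) , untail cs bs (proj₂ (same x) ∘ there))
  where
  untail : ∀ ds es {x} → (x ∈ support (suc v) ds → x ∈ v ∷ support (suc v) es) →
           x ∈ support (suc v) ds → x ∈ support (suc v) es
  untail ds es f x∈ with f x∈
  ... | here refl = ⊥-elim (<-irrefl refl (support-≥ (suc v) ds x∈))
  ... | there x∈′ = x∈′
support-injective v {true ∷ bs}  {false ∷ cs} _ same =
  ⊥-elim (<-irrefl refl (support-≥ (suc v) cs (proj₁ (same v) (here refl))))
support-injective v {false ∷ bs} {true ∷ cs}  _ same =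
  ⊥-elim (<-irrefl refl (support-≥ (suc v) bs (proj₂ (same v) (here refl))))
support-injective v {false ∷ bs} {false ∷ cs} len same =
  cong (false ∷_) (support-injective (suc v) (suc-injective len) same)

∈-support-applyUpTo⁺ : ∀ v (f : ℕ → Bool) n {i} → i < n → T (f i) → v + i ∈ support v (applyUpTo f n)
∈-support-applyUpTo⁺ v f (suc n) {zero} _ fi with f 0
... | true = here (+-identityʳ v)
∈-support-applyUpTo⁺ v f (suc n) {suc i} (s≤s i<n) fi
  with f 0 | subst (_∈ support (suc v) (applyUpTo (f ∘ suc) n)) (sym (+-suc v i))
                   (∈-support-applyUpTo⁺ (suc v) (f ∘ suc) n i<n fi)
... | true  | x∈ = there x∈
... | false | x∈ = x∈

∈-support-applyUpTo⁻ : ∀ v (f : ℕ → Bool) n {x} → x ∈ support v (applyUpTo f n) →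
  ∃ λ i → i < n × T (f i) × x ≡ v + i
∈-support-applyUpTo⁻ v f (suc n) x∈ with f 0 in f0
∈-support-applyUpTo⁻ v f (suc n) (here refl) | true =
  0 , s≤s z≤n , subst T (sym f0) tt , sym (+-identityʳ v)
∈-support-applyUpTo⁻ v f (suc n) (there x∈) | true
  with i , i<n , fi , x≡ ← ∈-support-applyUpTo⁻ (suc v) (f ∘ suc) n x∈ =
  suc i , s≤s i<n , fi , trans x≡ (sym (+-suc v i))
∈-support-applyUpTo⁻ v f (suc n) x∈ | false
  with i , i<n , fi , x≡ ← ∈-support-applyUpTo⁻ (suc v) (f ∘ suc) n x∈ =
  suc i , s≤s i<n , fi , trans x≡ (sym (+-suc v i))

decreasing⇒no-pinnacle : ∀ {xs z} → AllPairs ℤ._>_ xs → ¬ HasPinnacle xs z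
decreasing⇒no-pinnacle ((a>b All.∷ _) AllPairs.∷ _) (here a<b _) = ℤ.<-asym a<b a>b
decreasing⇒no-pinnacle (_ AllPairs.∷ decreasing) (there p) = decreasing⇒no-pinnacle decreasing p

increasing⇒no-pinnacle : ∀ {xs z} → AllPairs ℤ._<_ xs → ¬ HasPinnacle xs z
increasing⇒no-pinnacle (_ AllPairs.∷ ((b<c All.∷ _) AllPairs.∷ _)) (here _ c<b) = ℤ.<-asym b<c c<b
increasing⇒no-pinnacle (_ AllPairs.∷ increasing) (there p) = increasing⇒no-pinnacle increasing p

hasPinnacle-drop : ∀ {x y ys z} → y ℤ.< x → HasPinnacle (x ∷ y ∷ ys) z → HasPinnacle (y ∷ ys) z
hasPinnacle-drop y<x (here x<y _) = ⊥-elim (ℤ.<-asym x<y y<x)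
hasPinnacle-drop y<x (there p)    = p

alternate : {A : Set} → List A → List A → List A
alternate []       ys = ys
alternate (x ∷ xs) ys = x ∷ alternate ys xs

alternate↭ : {A : Set} (xs ys : List A) → alternate xs ys ↭ xs ++ ys
alternate↭ []       ys = ↭-refl
alternate↭ (x ∷ xs) ys = prep x (↭-trans (alternate↭ ys xs) (++-comm ys xs))

alternate-pinnacle⁻ : ∀ ds ps {z} → AllPairs ℤ._>_ ds → (∀ {d p} → d ∈ ds → p ∈ ps → d ℤ.< p) →
  length ps < length ds → HasPinnacle (alternate ds ps) z → z ∈ ps
alternate-pinnacle⁻ (d ∷ ds) [] decreasing _ _ pin = ⊥-elim (decreasing⇒no-pinnacle decreasing pin)
alternate-pinnacle⁻ (d ∷ d′ ∷ ds) (p ∷ ps) _ _ _ (here _ _) = here refl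
alternate-pinnacle⁻ (d ∷ d′ ∷ ds) (p ∷ ps) (_ AllPairs.∷ decreasing) below (s≤s shorter) (there pin) =
  there (alternate-pinnacle⁻ (d′ ∷ ds) ps decreasing (λ d∈ p∈ → below (there d∈) (there p∈)) shorter
    (hasPinnacle-drop (below (there (here refl)) (here refl)) pin))
alternate-pinnacle⁻ (d ∷ []) (p ∷ ps) _ _ (s≤s ()) _

alternate-pinnacle⁺ : ∀ ds ps {z} → (∀ {d p} → d ∈ ds → p ∈ ps → d ℤ.< p) →
  length ps < length ds → z ∈ ps → HasPinnacle (alternate ds ps) z
alternate-pinnacle⁺ (d ∷ d′ ∷ ds) (p ∷ ps) below _ (here refl) =
  here (below (here refl) (here refl)) (below (there (here refl)) (here refl))
alternate-pinnacle⁺ (d ∷ d′ ∷ ds) (p ∷ ps) below (s≤s shorter) (there z∈) =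
  there (there (alternate-pinnacle⁺ (d′ ∷ ds) ps (λ d∈ p∈ → below (there d∈) (there p∈)) shorter z∈))
alternate-pinnacle⁺ (d ∷ []) (p ∷ ps) _ (s≤s ()) _

signed-construction : ∀ bs → 2 * ones bs + 1 ≤ length bs → InAPS⁺ (length bs) (_∈ support 1 bs)
signed-construction bs light = list⇒InAPS⁺ (alternate ds ps) abs↭ (pinnacle⁻ , pinnacle⁺)
  where
  ds = map (λ x → ℤ.- + x) (nonSupport 1 bs)
  ps = map +_ (support 1 bs)

  decreasing : AllPairs ℤ._>_ ds
  decreasing = AllPairs.map⁺ (AllPairs.map (λ x<y → ℤ.neg-mono-< (ℤ.+<+ x<y)) (nonSupport-increasing 1 bs))

  below : ∀ {d p} → d ∈ ds → p ∈ ps → d ℤ.< p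
  below d∈ p∈ with x , x∈ , refl ← ∈-map⁻ _ d∈ | _ , _ , refl ← ∈-map⁻ _ p∈ with nonSupport-≥ 1 bs x∈
  ... | s≤s _ = ℤ.-<+

  shorter : length ps < length ds
  shorter = subst₂ _<_ (sym (trans (length-map +_ (support 1 bs)) (length-support 1 bs)))
    (sym (length-map (λ x → ℤ.- + x) (nonSupport 1 bs)))
    (+-cancelʳ-≤ (ones bs) _ _ (begin
      suc (ones bs) + ones bs              ≡⟨ twice+1 (ones bs) ⟨
      2 * ones bs + 1                      ≤⟨ light ⟩
      length bs                            ≡⟨ length-nonSupport 1 bs ⟨
      length (nonSupport 1 bs) + ones bs   ∎))
    where
    open ≤-Reasoning
    twice+1 : ∀ c → 2 * c + 1 ≡ suc c + c
    twice+1 = solve-∀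

  abs↭ : map ∣_∣ (alternate ds ps) ↭ upFrom 1 (length bs)
  abs↭ = ↭-trans (map⁺ ∣_∣ (alternate↭ ds ps)) (↭-trans (↭-reflexive abs≡) (nonSupport++support↭ 1 bs))
    where
    abs≡ : map ∣_∣ (ds ++ ps) ≡ nonSupport 1 bs ++ support 1 bs
    abs≡ = trans (map-++ ∣_∣ ds ps) (cong₂ _++_
      (trans (sym (map-∘ (nonSupport 1 bs))) (trans (map-cong (λ x → ℤ.∣-i∣≡∣i∣ (+ x)) _) (map-id _)))
      (map-∣∣-+ (support 1 bs)))

  pinnacle⁻ : ∀ z → HasPinnacle (alternate ds ps) z → ∃ λ x → (z ≡ + x) × x ∈ support 1 bs
  pinnacle⁻ z pin with x , x∈ , z≡ ← ∈-map⁻ +_ (alternate-pinnacle⁻ ds ps decreasing below shorter pin) =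
    x , z≡ , x∈

  pinnacle⁺ : ∀ x → x ∈ support 1 bs → HasPinnacle (alternate ds ps) (+ x)
  pinnacle⁺ x x∈ = alternate-pinnacle⁺ ds ps below shorter (∈-map⁺ +_ x∈)

-- Values v, v + 1, … are read off bs: a non-member joins a queue of pending values, and a member
-- is placed as a pinnacle right after the oldest pending value, the next oldest following it.
queueWord : ℕ → List Bool → List ℕ → List ℕ
queueWord v []           queue       = queue
queueWord v (false ∷ bs) queue       = queueWord (suc v) bs (queue ++ [ v ])
queueWord v (true ∷ bs)  (a ∷ queue) = a ∷ v ∷ queueWord (suc v) bs queue
queueWord v (true ∷ bs)  []          = []

queueWord-head : ∀ v bs a queue → ∃ λ rest → queueWord v bs (a ∷ queue) ≡ a ∷ rest
queueWord-head v []           a queue = queue , refl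
queueWord-head v (false ∷ bs) a queue = queueWord-head (suc v) bs a (queue ++ [ v ])
queueWord-head v (true ∷ bs)  a queue = _ , refl

record Queue (v : ℕ) (bs : List Bool) (queue : List ℕ) : Set where
  field
    increasing : AllPairs _<_ queue
    below      : All (_< v) queue
    walk       : T (ballot (length queue) bs)

queue-below : ∀ {v bs queue x} → Queue v bs queue → x ∈ queue → + x ℤ.< + v
queue-below q x∈ = ℤ.+<+ (All.lookup (Queue.below q) x∈)

enqueue : ∀ {v bs queue} → Queue v (false ∷ bs) queue → Queue (suc v) bs (queue ++ [ v ])
enqueue {v} {bs} {queue} q = record
  { increasing = AllPairs.++⁺ increasing (All.[] AllPairs.∷ AllPairs.[]) (All.map (All._∷ All.[]) below)
  ; below      = All.++⁺ (All.map m<n⇒m<1+n below) (n<1+n v All.∷ All.[])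
  ; walk       = subst (λ h → T (ballot h bs)) (sym (trans (length-++ queue) (+-comm _ 1))) walk
  }
  where open Queue q

dequeue : ∀ {v bs a b queue} → Queue v (true ∷ bs) (a ∷ b ∷ queue) → Queue (suc v) bs (b ∷ queue)
dequeue q = record
  { increasing = AllPairs.tail increasing
  ; below      = All.map m<n⇒m<1+n (All.tail below)
  ; walk       = walk
  }
  where open Queue q

queueWord-pinnacle⁻ : ∀ v bs queue {z} → Queue v bs queue →
  HasPinnacle (map +_ (queueWord v bs queue)) z → ∃ λ x → (z ≡ + x) × x ∈ support v bs
queueWord-pinnacle⁻ v [] queue q pin =
  ⊥-elim (increasing⇒no-pinnacle (AllPairs.map⁺ (AllPairs.map ℤ.+<+ (Queue.increasing q))) pin)
queueWord-pinnacle⁻ v (false ∷ bs) queue q pin = queueWord-pinnacle⁻ (suc v) bs _ (enqueue q) pin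
queueWord-pinnacle⁻ v (true ∷ bs) (a ∷ b ∷ queue) q pin
  with rest , ≡b∷rest ← queueWord-head (suc v) bs b queue
  with subst (λ w → HasPinnacle (+ a ∷ + v ∷ map +_ w) _) ≡b∷rest pin
... | here _ _   = v , refl , here refl
... | there pin′
  with x , z≡ , x∈ ← queueWord-pinnacle⁻ (suc v) bs (b ∷ queue) (dequeue q)
         (subst (λ w → HasPinnacle (map +_ w) _) (sym ≡b∷rest)
                (hasPinnacle-drop (queue-below q (there (here refl))) pin′)) =
  x , z≡ , there x∈

queueWord-pinnacle⁺ : ∀ v bs queue {x} → Queue v bs queue →
  x ∈ support v bs → HasPinnacle (map +_ (queueWord v bs queue)) (+ x)
queueWord-pinnacle⁺ v (false ∷ bs) queue q x∈ = queueWord-pinnacle⁺ (suc v) bs _ (enqueue q) x∈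
queueWord-pinnacle⁺ v (true ∷ bs) (a ∷ b ∷ queue) q (here refl)
  with rest , ≡b∷rest ← queueWord-head (suc v) bs b queue =
  subst (λ w → HasPinnacle (+ a ∷ + v ∷ map +_ w) (+ v)) (sym ≡b∷rest)
    (here (queue-below q (here refl)) (queue-below q (there (here refl))))
queueWord-pinnacle⁺ v (true ∷ bs) (a ∷ b ∷ queue) q (there x∈) =
  there (there (queueWord-pinnacle⁺ (suc v) bs (b ∷ queue) (dequeue q) x∈))

queueWord↭ : ∀ v bs queue → Queue v bs queue → queueWord v bs queue ↭ queue ++ upFrom v (length bs)
queueWord↭ v []           queue _ = ↭-reflexive (sym (++-identityʳ queue))
queueWord↭ v (false ∷ bs) queue q =
  ↭-trans (queueWord↭ (suc v) bs _ (enqueue q)) (↭-reflexive (++-assoc queue [ v ] _))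
queueWord↭ v (true ∷ bs) (a ∷ b ∷ queue) q =
  prep a (↭-trans (prep v (queueWord↭ (suc v) bs (b ∷ queue) (dequeue q))) (↭-sym (shift v (b ∷ queue) _)))

positive-construction : ∀ bs → T (ballot 0 bs) → InAPS (length bs) (_∈ support 1 bs)
positive-construction bs walk = list⇒InAPS (queueWord 1 bs []) (queueWord↭ 1 bs [] start)
  ((λ z → queueWord-pinnacle⁻ 1 bs [] start) , (λ x → queueWord-pinnacle⁺ 1 bs [] start))
  where
  start : Queue 1 bs []
  start = record { increasing = AllPairs.[] ; below = All.[] ; walk = walk }

-- The pinnacle word of a permutation

extend : {n : ℕ} → (Fin n → ℤ) → ℕ → ℤ
extend {n} w j with j <? n
... | yes j<n = w (fromℕ< j<n)
... | no  _   = + 0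

extend-toℕ : ∀ {n} (w : Fin n → ℤ) i → extend w (toℕ i) ≡ w i
extend-toℕ {n} w i with toℕ i <? n
... | yes i<n = cong w (fromℕ<-toℕ i i<n)
... | no  i≮n = ⊥-elim (i≮n (toℕ<n i))

extend-fromℕ< : ∀ {n} (w : Fin n → ℤ) {j} (j<n : j < n) → extend w j ≡ w (fromℕ< j<n)
extend-fromℕ< w = W-fromℕ< w (extend w) (extend-toℕ w)

record AbsPermutation (n : ℕ) (W : ℕ → ℤ) : Set where
  field
    abs-range     : ∀ {j} → j < n → 1 ≤ ∣ W j ∣ × ∣ W j ∣ ≤ n
    abs-injective : ∀ {i j} → i < n → j < n → ∣ W i ∣ ≡ ∣ W j ∣ → i ≡ j

signedPerm⇒absPermutation : ∀ {n} {w : Fin n → ℤ} → IsSignedPerm n w → AbsPermutation n (extend w)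
signedPerm⇒absPermutation {n} {w} (range , injective) = record
  { abs-range     = λ j<n →
      subst (λ z → 1 ≤ ∣ z ∣ × ∣ z ∣ ≤ n) (sym (extend-fromℕ< w j<n)) (range (fromℕ< j<n))
  ; abs-injective = λ i<n j<n eq → trans (sym (toℕ-fromℕ< i<n)) (trans (cong toℕ
      (injective _ _ (subst₂ (λ a b → ∣ a ∣ ≡ ∣ b ∣) (extend-fromℕ< w i<n) (extend-fromℕ< w j<n) eq)))
      (toℕ-fromℕ< j<n))
  }

module Pinnacles {n : ℕ} {W : ℕ → ℤ} (perm : AbsPermutation n W) where
  open AbsPermutation perm

  peakAt? : ∀ a → Dec (PeakAt n W a)
  peakAt? a = suc (suc a) <? n ×-dec W a ℤ.<? W (suc a) ×-dec W (suc (suc a)) ℤ.<? W (suc a)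

  isPinnacle? : ∀ z → Dec (IsPinnacleℕ n W z)
  isPinnacle? z = map′ (λ (a , _ , pin) → a , pin) (λ (a , peak , z≡) → a , a<n peak , peak , z≡)
    (anyUpTo? (λ a → peakAt? a ×-dec z ℤ.≟ W (suc a)) n)
    where
    a<n : ∀ {a} → PeakAt n W a → a < n
    a<n (a+2<n , _) = <-trans (n<1+n _) (<-trans (n<1+n _) a+2<n)

  peakBit : ℕ → Bool
  peakBit zero    = false
  peakBit (suc a) = isYes (peakAt? a)

  -- Bit v records whether v + 1 is a pinnacle.
  pinnacleBit : ℕ → Bool
  pinnacleBit v = isYes (isPinnacle? (+ suc v))

  position : ℕ → ℕ
  position v with isPinnacle? (+ suc v)
  ... | yes (a , _) = suc a
  ... | no  _       = 0

  position-peak : ∀ {v} → T (pinnacleBit v) →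
    position v < n × T (peakBit (position v)) × W (position v) ≡ + suc v
  position-peak {v} with isPinnacle? (+ suc v)
  ... | yes (a , peak , z≡) = λ _ → <-trans (n<1+n _) (proj₁ peak) , fromWitness peak , sym z≡

  PeakNeighboursBounded : ℕ → Set
  PeakNeighboursBounded m = ∀ a → PeakAt n W a → ∣ W (suc a) ∣ ≤ m → ∣ W a ∣ ≤ m × ∣ W (suc (suc a)) ∣ ≤ m

  pinnacle-bound : ∀ {m} → 1 ≤ m → PeakNeighboursBounded m → 2 * count pinnacleBit m + 1 ≤ m
  pinnacle-bound {m} 1≤m closed = begin
    2 * count pinnacleBit m + 1  ≤⟨ +-monoˡ-≤ 1 (*-monoʳ-≤ 2 pinnacles≤peaks) ⟩
    2 * count peak n + 1         ≤⟨ sparsePeaks-bound sparse 1≤m small≤m ⟩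
    m                            ∎
    where
    open ≤-Reasoning

    small : ℕ → Bool
    small j = ∣ W j ∣ ≤ᵇ m

    peak : ℕ → Bool
    peak j = peakBit j ∧ small j

    split : ∀ {j} → T (peak j) → T (peakBit j) × T (small j)
    split = Equivalence.to T-∧

    sparse : SparsePeaks n small peak
    sparse = record
      { no-peak-at-0   = refl
      ; peak-interior  = λ a pk → proj₁ (toWitness (proj₁ (split pk)))
      ; peak-small     = λ a pk →
          let (top , W≤m) = split pk ; (≤₁ , ≤₂) = closed a (toWitness top) (≤ᵇ⇒≤ _ m W≤m)
          in ≤⇒≤ᵇ ≤₁ , W≤m , ≤⇒≤ᵇ ≤₂
      ; peaks-isolated = isolated
      }
      where
      isolated : ∀ j → T (peak j) → ¬ T (peak (suc j))
      isolated (suc a) pk pk′ with _ , _ , Wa+2<Wa+1 ← toWitness (proj₁ (split pk))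
                                 | _ , Wa+1<Wa+2 , _ ← toWitness (proj₁ (split pk′)) =
        ℤ.<-asym Wa+2<Wa+1 Wa+1<Wa+2

    pred< : ∀ {x} → 1 ≤ x → x ≤ m → x ∸ 1 < m
    pred< (s≤s _) x≤m = x≤m

    small≤m : count small n ≤ m
    small≤m = subst (count small n ≤_) (count-true m)
      (count-≤-injection (λ j → ∣ W j ∣ ∸ 1) n m
        (λ j j<n sj → pred< (proj₁ (abs-range j<n)) (≤ᵇ⇒≤ _ m sj) , _)
        (λ i j i<n j<n _ _ eq →
          abs-injective i<n j<n (∸-cancelʳ-≡ (proj₁ (abs-range i<n)) (proj₁ (abs-range j<n)) eq)))

    pinnacles≤peaks : count pinnacleBit m ≤ count peak n
    pinnacles≤peaks = count-≤-injection position m n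
      (λ v v<m pv → let (pos<n , pk , W≡) = position-peak pv in
        pos<n , Equivalence.from T-∧ (pk , ≤⇒≤ᵇ (subst (_≤ m) (sym (cong ∣_∣ W≡)) v<m)))
      (λ u v _ _ pu pv pos≡ → suc-injective (ℤ.+-injective (trans (sym (proj₂ (proj₂ (position-peak pu))))
        (trans (cong W pos≡) (proj₂ (proj₂ (position-peak pv)))))))

  pinnacleBits : List Bool
  pinnacleBits = applyUpTo pinnacleBit n

  pinnacleBits-light : 1 ≤ n → 2 * ones pinnacleBits + 1 ≤ n
  pinnacleBits-light 1≤n =
    subst (λ c → 2 * c + 1 ≤ n) (sym (ones-applyUpTo pinnacleBit n)) (pinnacle-bound 1≤n closed)
    where
    closed : PeakNeighboursBounded n
    closed a (a+2<n , _) _ =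
      proj₂ (abs-range (<-trans (n<1+n a) (<-trans (n<1+n _) a+2<n))) , proj₂ (abs-range a+2<n)

  pinnacleBits-ballot : (∀ {j} → j < n → ℤ.+0 ℤ.< W j) → T (ballot 0 pinnacleBits)
  pinnacleBits-ballot positive = prefixBounds⇒ballot n 0 λ m 1≤m _ →
    subst (2 * count pinnacleBit m + 1 ≤_) (sym (+-identityʳ m)) (pinnacle-bound 1≤m closed)
    where
    ∣∣-mono-< : ∀ {i j} → ℤ.+0 ℤ.< i → i ℤ.< j → ∣ i ∣ < ∣ j ∣
    ∣∣-mono-< {+ _} {+ _} _ (ℤ.+<+ i<j) = i<j
    closed : ∀ {m} → PeakNeighboursBounded m
    closed a (a+2<n , Wa< , Wa+2<) ∣W∣≤m =
      <⇒≤ (<-≤-trans (∣∣-mono-< (positive (<-trans (n<1+n a) (<-trans (n<1+n _) a+2<n))) Wa<) ∣W∣≤m) ,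
      <⇒≤ (<-≤-trans (∣∣-mono-< (positive a+2<n) Wa+2<) ∣W∣≤m)

  pinnacle-range : ∀ {x} → IsPinnacleℕ n W (+ x) → 1 ≤ x × x ≤ n
  pinnacle-range (a , (a+2<n , _) , x≡) =
    subst (λ y → 1 ≤ y × y ≤ n) (cong ∣_∣ (sym x≡)) (abs-range (<-trans (n<1+n _) a+2<n))

  pinnacleBits-support : ∀ {S : ℕ → Set} →
    (∀ z → IsPinnacleℕ n W z → ∃ λ x → (z ≡ + x) × S x) → (∀ x → S x → IsPinnacleℕ n W (+ x)) →
    SameSet S (_∈ support 1 pinnacleBits)
  pinnacleBits-support {S} pinnacle⇒S S⇒pinnacle x = S⇒bit x , bit⇒S
    where
    S⇒bit : ∀ x → S x → x ∈ support 1 pinnacleBits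
    S⇒bit x Sx = pinnacle⇒bit x (S⇒pinnacle x Sx)
      where
      pinnacle⇒bit : ∀ x → IsPinnacleℕ n W (+ x) → x ∈ support 1 pinnacleBits
      pinnacle⇒bit zero    pin with () , _ ← pinnacle-range pin
      pinnacle⇒bit (suc v) pin =
        ∈-support-applyUpTo⁺ 1 pinnacleBit n (proj₂ (pinnacle-range pin)) (fromWitness pin)
    bit⇒S : x ∈ support 1 pinnacleBits → S x
    bit⇒S x∈ with i , _ , bit , refl ← ∈-support-applyUpTo⁻ 1 pinnacleBit n x∈
      with y , +suc≡ , Sy ← pinnacle⇒S (+ suc i) (toWitness bit) = subst S (sym (ℤ.+-injective +suc≡)) Sy

pinSet⇒support : ∀ {n} {w : Fin n → ℤ} {S} (signed : IsSignedPerm n w) → PinSetIs w S →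
  SameSet S (_∈ support 1 (Pinnacles.pinnacleBits (signedPerm⇒absPermutation {w = w} signed)))
pinSet⇒support {w = w} signed (pinnacle⇒S , S⇒pinnacle) = pinnacleBits-support
  (λ z pin → pinnacle⇒S z (isPinnacleℕ⇒ w (extend w) (extend-toℕ w) pin))
  (λ x Sx → isPinnacle⇒ℕ w (extend w) (extend-toℕ w) (S⇒pinnacle x Sx))
  where open Pinnacles (signedPerm⇒absPermutation {w = w} signed)

inAPS⁺⇒light : ∀ {n S} → 1 ≤ n → InAPS⁺ n S →
  ∃ λ bs → length bs ≡ n × 2 * ones bs + 1 ≤ n × SameSet S (_∈ support 1 bs)
inAPS⁺⇒light {n} 1≤n (w , signed , pinSet) =
  pinnacleBits , length-applyUpTo pinnacleBit n , pinnacleBits-light 1≤n , pinSet⇒support signed pinSet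
  where open Pinnacles (signedPerm⇒absPermutation {w = w} signed)

inAPS⇒ballot : ∀ {n S} → InAPS n S → ∀ bs → length bs ≡ n → SameSet S (_∈ support 1 bs) → T (ballot 0 bs)
inAPS⇒ballot {n} (w , (signed , positive) , pinSet) bs length≡ S≃bs =
  subst (T ∘ ballot 0) (support-injective 1 {pinnacleBits} {bs} same-length bits≃bs)
    (pinnacleBits-ballot λ j<n → subst (ℤ.+0 ℤ.<_) (sym (extend-fromℕ< w j<n)) (positive (fromℕ< j<n)))
  where
  open Pinnacles (signedPerm⇒absPermutation {w = w} signed)
  same-length = trans (length-applyUpTo pinnacleBit n) (sym length≡)
  S≃bits = pinSet⇒support signed pinSet
  bits≃bs : SameSet (_∈ support 1 pinnacleBits) (_∈ support 1 bs)
  bits≃bs x = proj₁ (S≃bs x) ∘ proj₂ (S≃bits x) , proj₁ (S≃bits x) ∘ proj₂ (S≃bs x)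

-- Counting APS⁺ ∖ APS

lookup-injective : {A : Set} {xs : List A} {i j : Fin (length xs)} →
  Unique xs → lookup xs i ≡ lookup xs j → i ≡ j
lookup-injective {xs = x ∷ xs} {Fin.zero}  {Fin.zero}  _ _ = refl
lookup-injective {xs = x ∷ xs} {Fin.zero}  {Fin.suc j} (x∉ AllPairs.∷ _) eq =
  ⊥-elim (All.lookup x∉ (∈-lookup j) eq)
lookup-injective {xs = x ∷ xs} {Fin.suc i} {Fin.zero}  (x∉ AllPairs.∷ _) eq =
  ⊥-elim (All.lookup x∉ (∈-lookup i) (sym eq))
lookup-injective {xs = x ∷ xs} {Fin.suc i} {Fin.suc j} (_ AllPairs.∷ unique) eq =
  cong Fin.suc (lookup-injective unique eq)

hasCard-list : {A : Set} (code : A → List ℕ) (P : (ℕ → Set) → Set) (L : List A) → Unique L →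
  (∀ {a b} → a ∈ L → b ∈ L → SameSet (_∈ code a) (_∈ code b) → a ≡ b) →
  (∀ {a} → a ∈ L → P (_∈ code a)) →
  (∀ S → P S → ∃ λ a → a ∈ L × SameSet S (_∈ code a)) →
  HasCard P (length L)
hasCard-list code P L unique code-injective sound complete =
  code ∘ lookup L ,
  (λ i → sound (∈-lookup i)) ,
  (λ i j same → lookup-injective unique (code-injective (∈-lookup i) (∈-lookup j) same)) ,
  λ S PS → let (a , a∈ , S≃a) = complete S PS in
    Any.index a∈ , subst (λ b → SameSet S (_∈ code b)) (lookup-index a∈) S≃a

hasCard-bitStrings : ∀ n (p : List Bool → Bool) (P : (ℕ → Set) → Set) →
  (∀ bs → length bs ≡ n → T (p bs) → P (_∈ support 1 bs)) →
  (∀ S → P S → ∃ λ bs → length bs ≡ n × T (p bs) × SameSet S (_∈ support 1 bs)) →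
  HasCard P (countᴸ p (bitStrings n))
hasCard-bitStrings n p P sound complete = subst (HasCard P) (length-filterᵇ p (bitStrings n))
  (hasCard-list (support 1) P (filterᵇ p (bitStrings n)) (Unique.filter⁺ (T? ∘ p) (bitStrings-unique n))
    (λ a∈ b∈ → support-injective 1 (trans (length≡ a∈) (sym (length≡ b∈))))
    (λ a∈ → sound _ (length≡ a∈) (proj₂ (∈-filter⁻ (T? ∘ p) {xs = bitStrings n} a∈)))
    λ S PS → let (bs , len , pbs , S≃bs) = complete S PS in
      bs , ∈-filter⁺ (T? ∘ p) (subst (λ m → bs ∈ bitStrings m) len (∈-bitStrings⁺ bs)) pbs , S≃bs)
  where
  length≡ : ∀ {bs} → bs ∈ filterᵇ p (bitStrings n) → length bs ≡ n
  length≡ bs∈ = ∈-bitStrings⁻ n (proj₁ (∈-filter⁻ (T? ∘ p) {xs = bitStrings n} bs∈))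

T-∧-not⁺ : ∀ {a b} → T a → ¬ T b → T (a ∧ not b)
T-∧-not⁺ {true} {false} _ _  = tt
T-∧-not⁺ {true} {true}  _ ¬b = ¬b tt

T-∧-not⁻ : ∀ {a b} → T (a ∧ not b) → T a × ¬ T b
T-∧-not⁻ {true} {false} _ = tt , λ ()

≤⇒twice+1≤ : ∀ {c k} → c ≤ k → 2 * c + 1 ≤ suc (2 * k)
≤⇒twice+1≤ {c} {k} c≤k = subst (2 * c + 1 ≤_) (+-comm (2 * k) 1) (+-monoˡ-≤ 1 (*-monoʳ-≤ 2 c≤k))

twice+1≤⇒≤ : ∀ {c k} → 2 * c + 1 ≤ suc (2 * k) → c ≤ k
twice+1≤⇒≤ {c} {k} h = *-cancelˡ-≤ 2 (≤-pred (subst (_≤ suc (2 * k)) (+-comm (2 * c) 1) h))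

ballot⇒ones≤ : ∀ k bs → length bs ≡ suc (2 * k) → T (ballot 0 bs) → ones bs ≤ k
ballot⇒ones≤ k bs length≡ walk =
  *-cancelˡ-≤ 2 (subst (λ m → 2 * ones bs ≤ pred m) length≡ (ballot₀-weight bs walk))

pinSet-resp-SameSet : ∀ {n} {w : Fin n → ℤ} {A B} → SameSet A B → PinSetIs w A → PinSetIs w B
pinSet-resp-SameSet A≃B (pin⇒A , A⇒pin) =
  (λ z pin → let (x , z≡ , Ax) = pin⇒A z pin in x , z≡ , proj₁ (A≃B x) Ax) ,
  (λ x Bx → A⇒pin x (proj₂ (A≃B x) Bx))

unbalanced : ℕ → List Bool → Bool
unbalanced k bs = (ones bs ≤ᵇ k) ∧ not (ballot 0 bs)

unbalanced-count : ∀ k → countᴸ (unbalanced k) (bitStrings (suc (2 * k))) ≡ 4 ^ k ∸ (2 * k) C k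
unbalanced-count k = begin
  countᴸ (unbalanced k) V
    ≡⟨ m+n∸n≡m _ (countᴸ (ballot 0) V) ⟨
  countᴸ (unbalanced k) V + countᴸ (ballot 0) V ∸ countᴸ (ballot 0) V
    ≡⟨ cong (_∸ countᴸ (ballot 0) V) (countᴸ-∧-not (λ bs → ones bs ≤ᵇ k) (ballot 0) V ballot⇒light) ⟩
  countᴸ (λ bs → ones bs ≤ᵇ k) V ∸ countᴸ (ballot 0) V
    ≡⟨ cong₂ _∸_ (light-count k) (ballot-count k) ⟩
  4 ^ k ∸ (2 * k) C k ∎
  where
  open ≡-Reasoning
  V = bitStrings (suc (2 * k))
  ballot⇒light : ∀ {bs} → bs ∈ V → T (ballot 0 bs) → T (ones bs ≤ᵇ k)
  ballot⇒light {bs} bs∈ walk = ≤⇒≤ᵇ (ballot⇒ones≤ k bs (∈-bitStrings⁻ (suc (2 * k)) bs∈) walk)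

unbalanced⇒APS⁺∖APS : ∀ k bs → length bs ≡ suc (2 * k) → T (unbalanced k bs) →
  InAPS⁺ (suc (2 * k)) (_∈ support 1 bs) × ¬ InAPS (suc (2 * k)) (_∈ support 1 bs)
unbalanced⇒APS⁺∖APS k bs length≡ u with light , ¬walk ← T-∧-not⁻ {ones bs ≤ᵇ k} u =
  subst (λ m → InAPS⁺ m (_∈ support 1 bs)) length≡ (signed-construction bs
    (subst (2 * ones bs + 1 ≤_) (sym length≡) (≤⇒twice+1≤ (≤ᵇ⇒≤ (ones bs) k light)))) ,
  λ aps → ¬walk (inAPS⇒ballot aps bs length≡ λ _ → (λ x∈ → x∈) , (λ x∈ → x∈))

APS⁺∖APS⇒unbalanced : ∀ k S → InAPS⁺ (suc (2 * k)) S × ¬ InAPS (suc (2 * k)) S →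
  ∃ λ bs → length bs ≡ suc (2 * k) × T (unbalanced k bs) × SameSet S (_∈ support 1 bs)
APS⁺∖APS⇒unbalanced k S (aps⁺ , ¬aps) with bs , length≡ , bound , S≃bs ← inAPS⁺⇒light (s≤s z≤n) aps⁺ =
  bs , length≡ , T-∧-not⁺ (≤⇒≤ᵇ (twice+1≤⇒≤ {ones bs} bound)) ¬walk , S≃bs
  where
  ¬walk : ¬ T (ballot 0 bs)
  ¬walk walk
    with w , perm , pinSet ← subst (λ m → InAPS m (_∈ support 1 bs)) length≡ (positive-construction bs walk) =
    ¬aps (w , perm , pinSet-resp-SameSet (λ x → proj₂ (S≃bs x) , proj₁ (S≃bs x)) pinSet)

theorem4p11 : (k : ℕ) →
    HasCard (λ S → InAPS⁺ (suc (2 * k)) S × ¬ InAPS (suc (2 * k)) S)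
            (4 ^ k ∸ ((2 * k) C k))
theorem4p11 k = subst (HasCard _) (unbalanced-count k)
  (hasCard-bitStrings (suc (2 * k)) (unbalanced k) _ (unbalanced⇒APS⁺∖APS k) (APS⁺∖APS⇒unbalanced k))
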